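{- $\overline{\chi_2}(\mathcal B')\ge 4$. That is, for a fixed horizontal line $e$ there exists a finite family of axis-parallel rectangles, each intersecting $e$, such that for every coloring of the family with $3$ colors there is a point of the plane contained in at least $2$ of the rectangles, all rectangles containing it having the same color.
   Context: Fix a horizontal line $e$ in the plane; $\mathcal B'$ denotes the family of all axis-parallel rectangles intersecting $e$. For a family $\mathcal F$ of planar regions and an integer $k\ge 2$, $\overline{\chi_k}(\mathcal F)$ is the smallest number $c$ such that every finite subfamily $\mathcal F'\subseteq\mathcal F$ admits a coloring of its members with $c$ colors in which, for every point $p$ of the plane contained in at least $k$ members of $\mathcal F'$, the members of $\mathcal F'$ containing $p$ do not all have the same color.
   Formalization: The horizontal line e is taken only at rational height, and the corners of the rectangles and the coordinates of the monochromatic point are taken in the rationals. -}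

module Defs where

open import Data.Rational using (ℚ; _≤_; _<_)
open import Data.Product using (_×_; proj₁; proj₂)

Point : Set
Point = ℚ × ℚ

record Rect : Set where
  constructor rect
  field
    x₁ x₂ y₁ y₂ : ℚ
    x₁<x₂ : x₁ < x₂
    y₁<y₂ : y₁ < y₂
open Rect public

_∈ᴿ_ : Point → Rect → Set
p ∈ᴿ r = (x₁ r ≤ proj₁ p × proj₁ p ≤ x₂ r) × (y₁ r ≤ proj₂ p × proj₂ p ≤ y₂ r)

-- The rectangle r intersects the horizontal line e = {y = c}.
IntersectsLine : ℚ → Rect → Set
IntersectsLine c r = y₁ r ≤ c × c ≤ y₂ r

-- Four rectangles crossing the line can be placed so that every two of them meet
-- at a point covered by no other one. In a 3-colouring two of the four share a
-- colour (pigeonhole), and their private meeting point lies in exactly these two.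
-- The configuration is checked by computation at the line y = 0 and then
-- translated vertically to y = c.
module Submission where

open import Defs
open import Agda.Builtin.FromNat using (Number; fromNat)
open import Agda.Builtin.FromNeg using (Negative)
open import Data.Unit using (tt)
open import Data.Nat using (ℕ)
open import Data.Nat.Properties using (n<1+n)
import Data.Nat as ℕ
import Data.Nat.Literals
open import Data.Fin using (Fin; zero; suc; _<_)
open import Data.Fin.Properties using (_≟_; _<?_; pigeonhole; <⇒≢; all?)
open import Data.Vec using ([]; _∷_; lookup)
open import Data.Rational using (ℚ; _+_; 0ℚ; _≤_)
open import Data.Rational.Literals using (number; negative)
open import Data.Rational.Properties
  using (_≤?_; +-monoʳ-≤; +-monoʳ-<; <-irrefl; <-≤-trans; ≮⇒≥; +-identityʳ)
  renaming (_<?_ to _<ℚ?_)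
open import Data.Product using (Σ; ∃; _×_; _,_)
open import Data.Sum using (_⊎_; inj₁; inj₂)
open import Function using (_∘_)
open import Relation.Nullary.Decidable using (Dec; True; toWitness; from-yes; _×-dec_; _⊎-dec_; _→-dec_)
open import Relation.Binary.PropositionalEquality using (_≡_; _≢_; refl; sym; subst)

instance
  ℕ-number : Number ℕ
  ℕ-number = Data.Nat.Literals.number

  ℚ-number : Number ℚ
  ℚ-number = number

  ℚ-negative : Negative ℚ
  ℚ-negative = negative

module PairwisePrivate {A Region : Set} (_∈_ : A → Region → Set) where

  OnlyIn : {n : ℕ} → (Fin n → Region) → Fin n → Fin n → A → Set
  OnlyIn R i j p = p ∈ R i × p ∈ R j × (∀ k → p ∈ R k → k ≡ i ⊎ k ≡ j)

  onlyIn? : (∀ p r → Dec (p ∈ r)) →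
            {n : ℕ} (R : Fin n → Region) (i j : Fin n) (p : A) → Dec (OnlyIn R i j p)
  onlyIn? _∈?_ R i j p =
    p ∈? R i ×-dec p ∈? R j ×-dec all? (λ k → p ∈? R k →-dec (k ≟ i ⊎-dec k ≟ j))

  MonochromaticPoint : {n m : ℕ} → (Fin n → Region) → (Fin n → Fin m) → Set
  MonochromaticPoint {n} R col =
    Σ A λ p → Σ (Fin n) λ i → Σ (Fin n) λ j →
      i ≢ j × p ∈ R i × p ∈ R j × ((k : Fin n) → p ∈ R k → col k ≡ col i)

  monochromaticPoint : {n m : ℕ} (R : Fin n → Region) → m ℕ.< n →
                       (∀ {i j} → i < j → ∃ (OnlyIn R i j)) →
                       (col : Fin n → Fin m) → MonochromaticPoint R col
  monochromaticPoint R m<n onlyIn col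
    with i , j , i<j , colᵢ≡colⱼ ← pigeonhole m<n col
    with p , p∈Rᵢ , p∈Rⱼ , only ← onlyIn i<j
    = p , i , j , <⇒≢ i<j , p∈Rᵢ , p∈Rⱼ , sameColour
    where
    sameColour : ∀ k → p ∈ R k → col k ≡ col i
    sameColour k p∈Rₖ with only k p∈Rₖ
    ... | inj₁ refl = refl
    ... | inj₂ refl = sym colᵢ≡colⱼ

open PairwisePrivate _∈ᴿ_

+-cancelˡ-≤ : ∀ r {p q} → r + p ≤ r + q → p ≤ q
+-cancelˡ-≤ r r+p≤r+q = ≮⇒≥ (λ q<p → <-irrefl refl (<-≤-trans (+-monoʳ-< r q<p) r+p≤r+q))

_∈ᴿ?_ : ∀ p r → Dec (p ∈ᴿ r)
(x , y) ∈ᴿ? r = (x₁ r ≤? x ×-dec x ≤? x₂ r) ×-dec (y₁ r ≤? y ×-dec y ≤? y₂ r)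

intersectsLine? : ∀ c r → Dec (IntersectsLine c r)
intersectsLine? c r = y₁ r ≤? c ×-dec c ≤? y₂ r

translateY : ℚ → Rect → Rect
translateY c (rect x₁ x₂ y₁ y₂ x₁<x₂ y₁<y₂) = rect x₁ x₂ (c + y₁) (c + y₂) x₁<x₂ (+-monoʳ-< c y₁<y₂)

translateYᵖ : ℚ → Point → Point
translateYᵖ c (x , y) = x , c + y

∈ᴿ-translateY : ∀ c {p} r → p ∈ᴿ r → translateYᵖ c p ∈ᴿ translateY c r
∈ᴿ-translateY c r (x∈ , (y₁≤y , y≤y₂)) = x∈ , (+-monoʳ-≤ c y₁≤y , +-monoʳ-≤ c y≤y₂)

∈ᴿ-translateY⁻ : ∀ c {p} r → translateYᵖ c p ∈ᴿ translateY c r → p ∈ᴿ r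
∈ᴿ-translateY⁻ c r (x∈ , (y₁≤y , y≤y₂)) = x∈ , (+-cancelˡ-≤ c y₁≤y , +-cancelˡ-≤ c y≤y₂)

intersectsLine-translateY : ∀ c {a} r → IntersectsLine a r → IntersectsLine (c + a) (translateY c r)
intersectsLine-translateY c r (y₁≤a , a≤y₂) = +-monoʳ-≤ c y₁≤a , +-monoʳ-≤ c a≤y₂

onlyIn-translateY : ∀ c {n} (R : Fin n → Rect) {i j p} →
                    OnlyIn R i j p → OnlyIn (translateY c ∘ R) i j (translateYᵖ c p)
onlyIn-translateY c R {i} {j} (p∈Rᵢ , p∈Rⱼ , only) =
  ∈ᴿ-translateY c (R i) p∈Rᵢ , ∈ᴿ-translateY c (R j) p∈Rⱼ ,
  λ k p∈Rₖ → only k (∈ᴿ-translateY⁻ c (R k) p∈Rₖ)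

box : (x₁ x₂ y₁ y₂ : ℚ) → {True (x₁ <ℚ? x₂)} → {True (y₁ <ℚ? y₂)} → Rect
box x₁ x₂ y₁ y₂ {x₁<x₂} {y₁<y₂} = rect x₁ x₂ y₁ y₂ (toWitness x₁<x₂) (toWitness y₁<y₂)

baseFamily : Fin 4 → Rect
baseFamily = lookup (box 0 4 -2 1 ∷ box 0 4 0 3 ∷ box 1 3 -3 2 ∷ box 2 5 -3 3 ∷ [])

baseFamily-meets-0 : ∀ i → IntersectsLine 0ℚ (baseFamily i)
baseFamily-meets-0 = from-yes (all? (λ i → intersectsLine? 0ℚ (baseFamily i)))

-- Only the values with i < j matter.
meetingPoint : Fin 4 → Fin 4 → Point
meetingPoint zero (suc zero) = 0 , 0
meetingPoint zero (suc (suc zero)) = 1 , -2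
meetingPoint zero (suc (suc (suc zero))) = 4 , -2
meetingPoint (suc zero) (suc (suc zero)) = 1 , 2
meetingPoint (suc zero) (suc (suc (suc zero))) = 2 , 3
meetingPoint (suc (suc zero)) (suc (suc (suc zero))) = 2 , -3
meetingPoint _ _ = 0 , 0

baseFamily-onlyIn : ∀ i j → i < j → OnlyIn baseFamily i j (meetingPoint i j)
baseFamily-onlyIn = from-yes (all? λ i → all? λ j →
  i <? j →-dec onlyIn? _∈ᴿ?_ baseFamily i j (meetingPoint i j))

mainTheorem10 : (c : ℚ) →
    Σ ℕ λ n → Σ (Fin n → Rect) λ R →
      ((i : Fin n) → IntersectsLine c (R i)) ×
      ((col : Fin n → Fin 3) →
        Σ Point λ p → Σ (Fin n) λ i → Σ (Fin n) λ j →
          i ≢ j × p ∈ᴿ R i × p ∈ᴿ R j ×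
          ((k : Fin n) → p ∈ᴿ R k → col k ≡ col i))
mainTheorem10 c = 4 , R , meets , monochromaticPoint R (n<1+n 3) onlyIn-R
  where
  R : Fin 4 → Rect
  R = translateY c ∘ baseFamily

  meets : ∀ i → IntersectsLine c (R i)
  meets i = subst (λ a → IntersectsLine a (R i)) (+-identityʳ c)
                  (intersectsLine-translateY c (baseFamily i) (baseFamily-meets-0 i))

  onlyIn-R : ∀ {i j} → i < j → ∃ (OnlyIn R i j)
  onlyIn-R {i} {j} i<j = translateYᵖ c (meetingPoint i j) ,
                         onlyIn-translateY c baseFamily (baseFamily-onlyIn i j i<j)
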